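{- Let $a_1\ge a_2\ge\cdots\ge a_n$ and $b_1\ge b_2\ge\cdots\ge b_m$ be two sequences of positive integers such that $n\le m$, $a_1\le m$, $\sum_{i=1}^n a_i=\sum_{i=1}^m b_i$, and $b_1\le b_m+1$. Let $A=\{u_1,\dots,u_n\}$ and $B=\{v_1,\dots,v_m\}$ be two disjoint sets of vertices. Then there exists a simple bipartite graph $G$ with parts $A$ and $B$ such that $G$ has a matching covering $A$, the degree of $u_i$ is $a_i$ for $1\le i\le n$, and the degree of $v_i$ is $b_i$ for $1\le i\le m$. -}

module Defs where

open import Data.Nat using (ℕ; zero; suc; _+_)
open import Data.Fin using (Fin; zero; suc)
open import Data.Bool using (Bool; true; false)

∑ : {n : ℕ} → (Fin n → ℕ) → ℕ
∑ {zero}  f = 0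
∑ {suc n} f = f zero + ∑ (λ i → f (suc i))

count : {n : ℕ} → (Fin n → Bool) → ℕ
count {zero}  p = 0
count {suc n} p = (if p zero then 1 else 0) + count (λ i → p (suc i))
  where
  if_then_else_ : Bool → ℕ → ℕ → ℕ
  if true  then x else y = x
  if false then x else y = y

-- A simple bipartite graph with parts A = {u_0..u_{n-1}} (Fin n) and
-- B = {v_0..v_{m-1}} (Fin m): adjacency is a Boolean relation, so each pair
-- u_i v_j carries at most one edge (simple), and no edges inside a part.
BipGraph : ℕ → ℕ → Set
BipGraph n m = Fin n → Fin m → Bool

degA : {n m : ℕ} → BipGraph n m → Fin n → ℕ
degA G i = count (λ j → G i j)

degB : {n m : ℕ} → BipGraph n m → Fin m → ℕ
degB G j = count (λ i → G i j)

open import Relation.Binary.PropositionalEquality using (_≡_)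
open import Data.Product using (Σ; _×_)

MatchingCoveringA : {n m : ℕ} → BipGraph n m → Set
MatchingCoveringA {n} {m} G =
  Σ (Fin n → Fin m) λ f →
    ((i : Fin n) → G i (f i) ≡ true) ×
    ((i i' : Fin n) → f i ≡ f i' → i ≡ i')

zeroOf : {n : ℕ} → Fin n → Fin n
zeroOf {suc n} _ = zero

lastOf : {n : ℕ} → Fin n → Fin n
lastOf {suc n} _ = Data.Fin.fromℕ n
  where import Data.Fin

module Submission where

-- The theorem is proved in the generalised form `realise`, by induction on
-- the number n of vertices of A.  Sortedness of b is only used to see that
-- b is near-regular (any two values differ by at most one); the induction
-- carries instead the residual degrees d of B, which stay near-regular, and
-- a set Z of B-vertices already used by the matching, which is kept "low"
-- (every member of Z has residual degree at most that of every non-member).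
--
-- Step: u₀ is joined to a set C of a₀ vertices of largest residual degree
-- (a top set, so decrementing d on C keeps it near-regular), and matched to
-- a partner p ∈ C outside Z.  Ties are broken so that Z ∪ {p} is again low
-- after the decrement (`star`, built in the module `StarChoice`).  Then
-- u₁ … uₙ₋₁ are realised recursively on the residual data (`extend`).

open import Defs
open import Data.Nat using (ℕ; zero; suc; _≤_; _<_; _+_; _∸_; z≤n; s≤s)
open import Data.Nat.Properties hiding (_≟_)
open import Data.Fin using (Fin; zero; suc) renaming (_≤_ to _≤ᶠ_)
open import Data.Fin.Properties using (_≟_; ¬∀⟶∃¬; ≤fromℕ)
open import Data.Bool using (Bool; true; false; _∨_; not)
import Data.Bool.Properties as Bool
open import Data.Product using (Σ; ∃; _×_; _,_; proj₁; proj₂)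
open import Data.Sum using (_⊎_; inj₁; inj₂)
open import Function using (_∘_)
open import Level using (Level)
open import Relation.Nullary using (¬_; does; yes; no; contradiction)
open import Relation.Nullary.Decidable using (dec-true; _×-dec_)
open import Relation.Unary using (Pred; Decidable)
open import Relation.Binary.Bundles using (TotalPreorder)
import Relation.Binary.Construct.Flip.EqAndOrd as Flip
open import Relation.Binary.PropositionalEquality
  using (_≡_; _≢_; refl; sym; trans; cong; cong₂; subst; subst₂; module ≡-Reasoning)
open import Algebra.Properties.CommutativeSemigroup +-commutativeSemigroup
  using (interchange)

private
  variable
    m n : ℕ

Subset : ℕ → Set
Subset m = Fin m → Bool

_∈_ _∉_ : Fin m → Subset m → Set
j ∈ S = S j ≡ true
j ∉ S = S j ≡ false

∈-or-∉ : (S : Subset m) (j : Fin m) → j ∈ S ⊎ j ∉ S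
∈-or-∉ S j with S j
... | true  = inj₁ refl
... | false = inj₂ refl

∈-∉-absurd : {S : Subset m} {j : Fin m} {A : Set} → j ∈ S → j ∉ S → A
∈-∉-absurd j∈S j∉S = contradiction (trans (sym j∈S) j∉S) λ ()

ind : Bool → ℕ
ind true  = 1
ind false = 0

ind≤1 : (b : Bool) → ind b ≤ 1
ind≤1 true  = s≤s z≤n
ind≤1 false = z≤n

insert : Fin m → Subset m → Subset m
insert x S j = S j ∨ does (j ≟ x)

insert-here : (x : Fin m) (S : Subset m) → x ∈ insert x S
insert-here x S rewrite dec-true (x ≟ x) refl = Bool.∨-zeroʳ (S x)

insert-old : (x : Fin m) {S : Subset m} {j : Fin m} → j ∈ S → j ∈ insert x S
insert-old x j∈S rewrite j∈S = refl

insert-cases : (x : Fin m) (S : Subset m) (j : Fin m) →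
  j ∈ insert x S → j ∈ S ⊎ j ≡ x
insert-cases x S j j∈ with S j | j ≟ x
... | true  | _         = inj₁ refl
... | false | yes j≡x   = inj₂ j≡x

insert-∉ : (x : Fin m) (S : Subset m) (j : Fin m) →
  j ∉ insert x S → j ∉ S × j ≢ x
insert-∉ x S j j∉ with S j | j ≟ x
... | false | no j≢x = refl , j≢x

count-suc : (S : Subset (suc m)) → count S ≡ ind (S zero) + count (S ∘ suc)
count-suc S with S zero
... | true  = refl
... | false = refl

count-ext : {S T : Subset m} → (∀ j → S j ≡ T j) → count S ≡ count T
count-ext {zero}  S≡T = refl
count-ext {suc m} {S} {T} S≡T = begin
  count S                            ≡⟨ count-suc S ⟩
  ind (S zero) + count (S ∘ suc)     ≡⟨ cong₂ _+_ (cong ind (S≡T zero)) (count-ext (S≡T ∘ suc)) ⟩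
  ind (T zero) + count (T ∘ suc)     ≡⟨ count-suc T ⟨
  count T                            ∎
  where open ≡-Reasoning

count-empty : count {m} (λ _ → false) ≡ 0
count-empty {zero}  = refl
count-empty {suc m} = count-empty {m}

count-full : (S : Subset m) → (∀ j → j ∈ S) → count S ≡ m
count-full {zero}  S full = refl
count-full {suc m} S full = begin
  count S                         ≡⟨ count-suc S ⟩
  ind (S zero) + count (S ∘ suc)  ≡⟨ cong₂ _+_ (cong ind (full zero)) (count-full (S ∘ suc) (full ∘ suc)) ⟩
  suc m                           ∎
  where open ≡-Reasoning

count-insert : (S : Subset m) (x : Fin m) → x ∉ S →
  count (insert x S) ≡ suc (count S)
count-insert {suc m} S zero x∉S = begin
  count (insert zero S)                          ≡⟨ count-suc (insert zero S) ⟩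
  ind (S zero ∨ true) + count (λ i → S (suc i) ∨ false)
    ≡⟨ cong₂ _+_ (cong ind (Bool.∨-zeroʳ (S zero))) (count-ext (Bool.∨-identityʳ ∘ S ∘ suc)) ⟩
  suc (count (S ∘ suc))                          ≡⟨ cong (λ b → suc (ind b + count (S ∘ suc))) x∉S ⟨
  suc (ind (S zero) + count (S ∘ suc))           ≡⟨ cong suc (count-suc S) ⟨
  suc (count S)                                  ∎
  where open ≡-Reasoning
count-insert {suc m} S (suc x) x∉S = begin
  count (insert (suc x) S)                       ≡⟨ count-suc (insert (suc x) S) ⟩
  ind (S zero ∨ false) + count (insert x (S ∘ suc))
    ≡⟨ cong₂ _+_ (cong ind (Bool.∨-identityʳ (S zero))) (count-insert (S ∘ suc) x x∉S) ⟩
  ind (S zero) + suc (count (S ∘ suc))           ≡⟨ +-suc (ind (S zero)) _ ⟩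
  suc (ind (S zero) + count (S ∘ suc))           ≡⟨ cong suc (count-suc S) ⟨
  suc (count S)                                  ∎
  where open ≡-Reasoning

missing : (S : Subset m) → count S < m → ∃ λ j → j ∉ S
missing {m} S small with ¬∀⟶∃¬ m (_∈ S) (λ j → S j Bool.≟ true) full⇒large
  where
  full⇒large : ¬ (∀ j → j ∈ S)
  full⇒large full = <⇒≱ small (≤-reflexive (sym (count-full S full)))
... | j , j∉S = j , Bool.¬-not j∉S

∑-ext : {f g : Fin m → ℕ} → (∀ j → f j ≡ g j) → ∑ f ≡ ∑ g
∑-ext {zero}  f≡g = refl
∑-ext {suc m} f≡g = cong₂ _+_ (f≡g zero) (∑-ext (f≡g ∘ suc))

∑-+ : (f g : Fin m → ℕ) → ∑ (λ j → f j + g j) ≡ ∑ f + ∑ g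
∑-+ {zero}  f g = refl
∑-+ {suc m} f g = trans (cong (f zero + g zero +_) (∑-+ (f ∘ suc) (g ∘ suc)))
                        (interchange (f zero) (g zero) (∑ (f ∘ suc)) (∑ (g ∘ suc)))

∑-mono : (f g : Fin m → ℕ) → (∀ j → f j ≤ g j) → ∑ f ≤ ∑ g
∑-mono {zero}  f g f≤g = z≤n
∑-mono {suc m} f g f≤g = +-mono-≤ (f≤g zero) (∑-mono (f ∘ suc) (g ∘ suc) (f≤g ∘ suc))

∑-strict : (f g : Fin m → ℕ) → (∀ j → f j ≤ g j) → (j : Fin m) → f j < g j → ∑ f < ∑ g
∑-strict {suc m} f g f≤g zero    f<g = +-mono-<-≤ f<g (∑-mono (f ∘ suc) (g ∘ suc) (f≤g ∘ suc))
∑-strict {suc m} f g f≤g (suc j) f<g = +-mono-≤-< (f≤g zero) (∑-strict (f ∘ suc) (g ∘ suc) (f≤g ∘ suc) j f<g)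

∑≡0 : (f : Fin m → ℕ) → ∑ f ≡ 0 → ∀ j → f j ≡ 0
∑≡0 {suc m} f ∑f≡0 zero    = m+n≡0⇒m≡0 (f zero) ∑f≡0
∑≡0 {suc m} f ∑f≡0 (suc j) = ∑≡0 (f ∘ suc) (m+n≡0⇒n≡0 (f zero) ∑f≡0) j

count≡∑ : (S : Subset m) → count S ≡ ∑ (ind ∘ S)
count≡∑ {zero}  S = refl
count≡∑ {suc m} S = trans (count-suc S) (cong (ind (S zero) +_) (count≡∑ (S ∘ suc)))

module Extremum {c ℓ₁ ℓ₂} (O : TotalPreorder c ℓ₁ ℓ₂) where
  open TotalPreorder O using (total)
    renaming (Carrier to K; _≲_ to _≼_; refl to ≼-refl; trans to ≼-trans)

  Greatest : {p : Level} (P : Pred (Fin m) p) → (Fin m → K) → Fin m → Set _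
  Greatest P κ x = P x × (∀ v → P v → κ v ≼ κ x)

  greatest? : {p : Level} {P : Pred (Fin m) p} → Decidable P → (κ : Fin m → K) →
    (∀ v → ¬ P v) ⊎ ∃ (Greatest P κ)
  greatest? {zero} P? κ = inj₁ λ ()
  greatest? {suc m} P? κ with P? zero | greatest? (P? ∘ suc) (κ ∘ suc)
  ... | no ¬P₀ | inj₁ none = inj₁ λ { zero → ¬P₀ ; (suc v) → none v }
  ... | no ¬P₀ | inj₂ (x , Px , top) =
    inj₂ (suc x , Px , λ { zero P₀ → contradiction P₀ ¬P₀ ; (suc v) Pv → top v Pv })
  ... | yes P₀ | inj₁ none =
    inj₂ (zero , P₀ , λ { zero _ → ≼-refl ; (suc v) Pv → contradiction Pv (none v) })
  ... | yes P₀ | inj₂ (x , Px , top) with total (κ zero) (κ (suc x))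
  ...   | inj₁ κ₀≼κx = inj₂ (suc x , Px , λ { zero _ → κ₀≼κx ; (suc v) Pv → top v Pv })
  ...   | inj₂ κx≼κ₀ = inj₂ (zero , P₀ , λ { zero _ → ≼-refl ; (suc v) Pv → ≼-trans (top v Pv) κx≼κ₀ })

  greatest : {p : Level} {P : Pred (Fin m) p} → Decidable P → (κ : Fin m → K) →
    ∃ P → ∃ (Greatest P κ)
  greatest P? κ (w , Pw) with greatest? P? κ
  ... | inj₁ none = contradiction Pw (none w)
  ... | inj₂ best = best

open Extremum ≤-totalPreorder using () renaming (greatest to argmax)
open Extremum (Flip.totalPreorder ≤-totalPreorder) using () renaming (greatest to argmin)

IsTop : (Fin m → ℕ) → Subset m → Set
IsTop κ C = ∀ j w → j ∈ C → w ∉ C → κ w ≤ κ j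

-- For every k ≤ m there is a top set of size k: grow it one element at a
-- time, always adding a largest element outside it.
topSet : (κ : Fin m → ℕ) (k : ℕ) → k ≤ m → Σ (Subset m) λ U → count U ≡ k × IsTop κ U
topSet {m} κ zero _ = (λ _ → false) , count-empty {m} , λ j w ()
topSet {m} κ (suc k) k<m with topSet κ k (≤-trans (n≤1+n k) k<m)
... | U , size , top = insert x U , trans (count-insert U x x∉U) (cong suc size) , top′
  where
  outside : ∃ (_∉ U)
  outside = missing U (subst (_< m) (sym size) k<m)

  best : Σ (Fin m) λ x → x ∉ U × (∀ v → v ∉ U → κ v ≤ κ x)
  best = argmax (λ j → U j Bool.≟ false) κ outside

  x : Fin m
  x = proj₁ best

  x∉U : x ∉ U
  x∉U = proj₁ (proj₂ best)

  top′ : IsTop κ (insert x U)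
  top′ j w j∈ w∉ with insert-cases x U j j∈ | insert-∉ x U w w∉
  ... | inj₁ j∈U  | w∉U , _ = top j w j∈U w∉U
  ... | inj₂ refl | w∉U , _ = proj₂ (proj₂ best) w w∉U

-- Tie-breaking keys.  `preferring d S` orders by d, and among equal values
-- puts members of S above non-members.

preferring : (Fin m → ℕ) → Subset m → Fin m → ℕ
preferring d S j = d j + d j + ind (S j)

halve : {a b : ℕ} → a + a ≤ suc (b + b) → a ≤ b
halve {a} {b} a+a≤ = ≮⇒≥ λ b<a → 1+n≰n (begin
  suc (suc (b + b))  ≡⟨ cong suc (+-suc b b) ⟨
  suc b + suc b      ≤⟨ +-mono-≤ b<a b<a ⟩
  a + a              ≤⟨ a+a≤ ⟩
  suc (b + b)        ∎)
  where open ≤-Reasoning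

preferring-≤ : (d : Fin m → ℕ) (S : Subset m) {w j : Fin m} →
  preferring d S w ≤ preferring d S j → d w ≤ d j
preferring-≤ d S {w} {j} le = halve (begin
  d w + d w                 ≤⟨ m≤m+n (d w + d w) _ ⟩
  preferring d S w          ≤⟨ le ⟩
  d j + d j + ind (S j)     ≤⟨ +-monoʳ-≤ (d j + d j) (ind≤1 (S j)) ⟩
  d j + d j + 1             ≡⟨ +-comm (d j + d j) 1 ⟩
  suc (d j + d j)           ∎)
  where open ≤-Reasoning

preferring-< : (d : Fin m → ℕ) (S : Subset m) {z w : Fin m} → z ∈ S → w ∉ S →
  preferring d S z ≤ preferring d S w → d z < d w
preferring-< d S {z} {w} z∈S w∉S le = halve (begin
  suc (d z) + suc (d z)     ≡⟨ cong suc (+-suc (d z) (d z)) ⟩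
  suc (suc (d z + d z))     ≡⟨ cong suc (+-comm 1 (d z + d z)) ⟩
  suc (d z + d z + 1)       ≡⟨ cong (λ b → suc (d z + d z + ind b)) z∈S ⟨
  suc (preferring d S z)    ≤⟨ s≤s le ⟩
  suc (preferring d S w)    ≡⟨ cong (λ b → suc (d w + d w + ind b)) w∉S ⟩
  suc (d w + d w + 0)       ≡⟨ cong suc (+-identityʳ (d w + d w)) ⟩
  suc (d w + d w)           ∎)
  where open ≤-Reasoning

NearRegular : (Fin m → ℕ) → Set
NearRegular d = ∀ j j' → d j ≤ suc (d j')

IsLow : (Fin m → ℕ) → Subset m → Set
IsLow d Z = ∀ z w → z ∈ Z → w ∉ Z → d z ≤ d w

_⊖_ : (Fin m → ℕ) → Subset m → Fin m → ℕ
(d ⊖ C) j = d j ∸ ind (C j)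

⊖-∈ : (d : Fin m → ℕ) (C : Subset m) {j : Fin m} → j ∈ C → (d ⊖ C) j ≡ d j ∸ 1
⊖-∈ d C {j} j∈C = cong (λ b → d j ∸ ind b) j∈C

⊖-∉ : (d : Fin m → ℕ) (C : Subset m) {j : Fin m} → j ∉ C → (d ⊖ C) j ≡ d j
⊖-∉ d C {j} j∉C = cong (λ b → d j ∸ ind b) j∉C

⊖-nearRegular : (d : Fin m → ℕ) (C : Subset m) → NearRegular d → IsTop d C →
  NearRegular (d ⊖ C)
⊖-nearRegular d C nr top j j' with ∈-or-∉ C j | ∈-or-∉ C j'
... | inj₁ j∈ | inj₁ j'∈ rewrite ⊖-∈ d C j∈ | ⊖-∈ d C j'∈ =
  ≤-trans (∸-monoˡ-≤ 1 (nr j j')) (m≤n+m∸n (d j') 1)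
... | inj₁ j∈ | inj₂ j'∉ rewrite ⊖-∈ d C j∈ | ⊖-∉ d C j'∉ =
  ≤-trans (m∸n≤m (d j) 1) (nr j j')
... | inj₂ j∉ | inj₁ j'∈ rewrite ⊖-∉ d C j∉ | ⊖-∈ d C j'∈ =
  ≤-trans (top j' j j'∈ j∉) (m≤n+m∸n (d j') 1)
... | inj₂ j∉ | inj₂ j'∉ rewrite ⊖-∉ d C j∉ | ⊖-∉ d C j'∉ = nr j j'

-- If a top set C of a near-regular d is no larger than ∑ d, then d is
-- positive on C: a zero on C would force d ≤ 1 on C and d = 0 off C.
top-positive : (d : Fin m → ℕ) (C : Subset m) → NearRegular d → IsTop d C →
  count C ≤ ∑ d → ∀ j → j ∈ C → 1 ≤ d j
top-positive d C nr top C≤∑d j j∈C = n≢0⇒n>0 λ dj≡0 → <⇒≱ (∑d<count dj≡0) C≤∑d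
  where
  ∑d<count : d j ≡ 0 → ∑ d < count C
  ∑d<count dj≡0 = subst (∑ d <_) (sym (count≡∑ C))
    (∑-strict d (ind ∘ C) below-indicator j (subst₂ (λ k b → k < ind b) (sym dj≡0) (sym j∈C) (s≤s z≤n)))
    where
    below-indicator : ∀ w → d w ≤ ind (C w)
    below-indicator w with ∈-or-∉ C w
    ... | inj₁ w∈ = subst (λ b → d w ≤ ind b) (sym w∈) (subst (λ k → d w ≤ suc k) dj≡0 (nr w j))
    ... | inj₂ w∉ = subst (λ b → d w ≤ ind b) (sym w∉) (subst (d w ≤_) dj≡0 (top j w j∈C w∉))

⊖-restore : (d : Fin m → ℕ) (C : Subset m) → (∀ j → j ∈ C → 1 ≤ d j) →
  ∀ j → ind (C j) + (d ⊖ C) j ≡ d j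
⊖-restore d C positive j with ∈-or-∉ C j
... | inj₁ j∈ = subst (λ b → ind b + (d j ∸ ind b) ≡ d j) (sym j∈) (m+[n∸m]≡n (positive j j∈))
... | inj₂ j∉ = subst (λ b → ind b + (d j ∸ ind b) ≡ d j) (sym j∉) refl

∑-⊖ : (d : Fin m → ℕ) (C : Subset m) → (∀ j → j ∈ C → 1 ≤ d j) →
  count C + ∑ (d ⊖ C) ≡ ∑ d
∑-⊖ d C positive = begin
  count C + ∑ (d ⊖ C)               ≡⟨ cong (_+ ∑ (d ⊖ C)) (count≡∑ C) ⟩
  ∑ (ind ∘ C) + ∑ (d ⊖ C)           ≡⟨ ∑-+ (ind ∘ C) (d ⊖ C) ⟨
  ∑ (λ j → ind (C j) + (d ⊖ C) j)   ≡⟨ ∑-ext (⊖-restore d C positive) ⟩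
  ∑ d                               ∎
  where open ≡-Reasoning

insert-low : (d : Fin m → ℕ) (C Z : Subset m) (p : Fin m) →
  NearRegular d → IsLow d Z → p ∈ C →
  (∀ w → w ∈ C → w ∉ Z → d p ≤ d w) →
  (∀ z w → z ∈ Z → z ∉ C → w ∈ C → w ∉ Z → w ≢ p → d z < d w) →
  IsLow (d ⊖ C) (insert p Z)
insert-low d C Z p nr low p∈C least above z w z∈ w∉ with insert-∉ p Z w w∉ | insert-cases p Z z z∈
... | w∉Z , w≢p | inj₁ z∈Z = from-Z z∈Z w∉Z w≢p
  where
  from-Z : z ∈ Z → w ∉ Z → w ≢ p → (d ⊖ C) z ≤ (d ⊖ C) w
  from-Z z∈Z w∉Z w≢p with ∈-or-∉ C z | ∈-or-∉ C w
  ... | inj₁ z∈C | inj₁ w∈C rewrite ⊖-∈ d C z∈C | ⊖-∈ d C w∈C = ∸-monoˡ-≤ 1 (low z w z∈Z w∉Z)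
  ... | inj₁ z∈C | inj₂ w∉C rewrite ⊖-∈ d C z∈C | ⊖-∉ d C w∉C = ≤-trans (m∸n≤m (d z) 1) (low z w z∈Z w∉Z)
  ... | inj₂ z∉C | inj₁ w∈C rewrite ⊖-∉ d C z∉C | ⊖-∈ d C w∈C = ∸-monoˡ-≤ 1 (above z w z∈Z z∉C w∈C w∉Z w≢p)
  ... | inj₂ z∉C | inj₂ w∉C rewrite ⊖-∉ d C z∉C | ⊖-∉ d C w∉C = low z w z∈Z w∉Z
... | w∉Z , _ | inj₂ refl = from-partner w∉Z
  where
  from-partner : w ∉ Z → (d ⊖ C) p ≤ (d ⊖ C) w
  from-partner w∉Z with ∈-or-∉ C w
  ... | inj₁ w∈C rewrite ⊖-∈ d C p∈C | ⊖-∈ d C w∈C = ∸-monoˡ-≤ 1 (least w w∈C w∉Z)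
  ... | inj₂ w∉C rewrite ⊖-∈ d C p∈C | ⊖-∉ d C w∉C = ∸-monoˡ-≤ 1 (nr p w)

record Star (d : Fin m → ℕ) (Z : Subset m) (k : ℕ) : Set where
  field
    C         : Subset m
    partner   : Fin m
    size      : count C ≡ k
    top       : IsTop d C
    partner∈C : partner ∈ C
    partner∉Z : partner ∉ Z
    low       : IsLow (d ⊖ C) (insert partner Z)

-- C consists of the k largest
-- values, ties broken towards Z (the set U), together with a largest value
-- x outside U, ties broken away from Z.  The partner is x if x ∉ Z;
-- otherwise all of B ∖ Z lies in U and the partner is a least element of
-- U ∖ Z.
module StarChoice {m : ℕ} (d : Fin m → ℕ) (Z : Subset m) (k : ℕ)
  (nr : NearRegular d) (low : IsLow d Z) (free : count Z < m) (k<m : k < m) where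

  private
    upper : Σ (Subset m) λ U → count U ≡ k × IsTop (preferring d Z) U
    upper = topSet (preferring d Z) k (<⇒≤ k<m)

  U : Subset m
  U = proj₁ upper

  U-top : IsTop (preferring d Z) U
  U-top = proj₂ (proj₂ upper)

  private
    best : Σ (Fin m) λ x → x ∉ U × (∀ v → v ∉ U → preferring d (not ∘ Z) v ≤ preferring d (not ∘ Z) x)
    best = argmax (λ j → U j Bool.≟ false) (preferring d (not ∘ Z))
                  (missing U (subst (_< m) (sym (proj₁ (proj₂ upper))) k<m))

  x : Fin m
  x = proj₁ best

  x∉U : x ∉ U
  x∉U = proj₁ (proj₂ best)

  C : Subset m
  C = insert x U

  C-size : count C ≡ suc k
  C-size = trans (count-insert U x x∉U) (cong suc (proj₁ (proj₂ upper)))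

  C-top : IsTop d C
  C-top j w j∈C w∉C with insert-cases x U j j∈C | insert-∉ x U w w∉C
  ... | inj₁ j∈U  | w∉U , _ = preferring-≤ d Z (U-top j w j∈U w∉U)
  ... | inj₂ refl | w∉U , _ = preferring-≤ d (not ∘ Z) (proj₂ (proj₂ best) w w∉U)

  -- Members of U ∖ Z lie strictly above the members of Z outside C,
  -- since U prefers Z on ties.
  U-above : ∀ z w → z ∈ Z → z ∉ C → w ∈ U → w ∉ Z → d z < d w
  U-above z w z∈Z z∉C w∈U w∉Z =
    preferring-< d Z z∈Z w∉Z (U-top w z w∈U (proj₁ (insert-∉ x U z z∉C)))

  Partner : Set
  Partner = Σ (Fin m) λ p → p ∈ C × p ∉ Z × (∀ w → w ∈ C → w ∉ Z → d p ≤ d w) × (x ∉ Z → p ≡ x)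

  -- If x ∈ Z then U contains all of B ∖ Z: a vertex outside both would
  -- beat x, which x's maximality and the lowness of Z forbid.
  x∈Z⇒free⊆U : x ∈ Z → ∀ w → w ∉ Z → w ∈ U
  x∈Z⇒free⊆U x∈Z w w∉Z with ∈-or-∉ U w
  ... | inj₁ w∈U = w∈U
  ... | inj₂ w∉U = contradiction (low x w x∈Z w∉Z) (<⇒≱ (preferring-< d (not ∘ Z)
        (cong not w∉Z) (cong not x∈Z) (proj₂ (proj₂ best) w w∉U)))

  partner : Partner
  partner with ∈-or-∉ Z x
  ... | inj₂ x∉Z = x , insert-here x U , x∉Z , least , λ _ → refl
    where
    least : ∀ w → w ∈ C → w ∉ Z → d x ≤ d w
    least w w∈C w∉Z with insert-cases x U w w∈C
    ... | inj₁ w∈U = preferring-≤ d Z (U-top w x w∈U x∉U)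
    ... | inj₂ refl = ≤-refl
  ... | inj₁ x∈Z = p , insert-old x {U} p∈U , p∉Z , least , λ x∉Z → ∈-∉-absurd {S = Z} x∈Z x∉Z
    where
    some-free : ∃ (_∉ Z)
    some-free = missing Z free
    lowest : Σ (Fin m) λ p → (p ∈ U × p ∉ Z) × (∀ v → v ∈ U × v ∉ Z → d p ≤ d v)
    lowest = argmin (λ j → (U j Bool.≟ true) ×-dec (Z j Bool.≟ false)) d
                    (proj₁ some-free , x∈Z⇒free⊆U x∈Z _ (proj₂ some-free) , proj₂ some-free)
    p : Fin m
    p = proj₁ lowest
    p∈U : p ∈ U
    p∈U = proj₁ (proj₁ (proj₂ lowest))
    p∉Z : p ∉ Z
    p∉Z = proj₂ (proj₁ (proj₂ lowest))
    least : ∀ w → w ∈ C → w ∉ Z → d p ≤ d w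
    least w w∈C w∉Z with insert-cases x U w w∈C
    ... | inj₁ w∈U = proj₂ (proj₂ lowest) w (w∈U , w∉Z)
    ... | inj₂ refl = ∈-∉-absurd {S = Z} x∈Z w∉Z

  star : Star d Z (suc k)
  star with partner
  ... | p , p∈C , p∉Z , least , x-first = record
    { C = C ; partner = p ; size = C-size ; top = C-top
    ; partner∈C = p∈C ; partner∉Z = p∉Z
    ; low = insert-low d C Z p nr low p∈C least above }
    where
    above : ∀ z w → z ∈ Z → z ∉ C → w ∈ C → w ∉ Z → w ≢ p → d z < d w
    above z w z∈Z z∉C w∈C w∉Z w≢p with insert-cases x U w w∈C
    ... | inj₁ w∈U = U-above z w z∈Z z∉C w∈U w∉Z
    ... | inj₂ refl = contradiction (sym (x-first w∉Z)) w≢p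

star : (d : Fin m → ℕ) (Z : Subset m) {k : ℕ} → NearRegular d → IsLow d Z →
  count Z < m → 1 ≤ k → k ≤ m → Star d Z k
star d Z nr low free (s≤s {n = k} z≤n) k<m = StarChoice.star d Z k nr low free k<m

record Realisation (a : Fin n → ℕ) (d : Fin m → ℕ) (Z : Subset m) : Set where
  field
    graph           : BipGraph n m
    match           : Fin n → Fin m
    matched         : ∀ i → graph i (match i) ≡ true
    match-injective : ∀ i i' → match i ≡ match i' → i ≡ i'
    match-avoids    : ∀ i → match i ∉ Z
    degA-ok         : ∀ i → degA graph i ≡ a i
    degB-ok         : ∀ j → degB graph j ≡ d j

extend : {a : Fin (suc n) → ℕ} {d : Fin m → ℕ} {Z : Subset m} (s : Star d Z (a zero)) →
  (∀ j → j ∈ Star.C s → 1 ≤ d j) →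
  Realisation (a ∘ suc) (d ⊖ Star.C s) (insert (Star.partner s) Z) →
  Realisation a d Z
extend {d = d} {Z} s positive r = record
  { graph           = graph′
  ; match           = match′
  ; matched         = λ { zero → partner∈C ; (suc i) → matched i }
  ; match-injective = injective
  ; match-avoids    = λ { zero → partner∉Z ; (suc i) → proj₁ (insert-∉ partner Z _ (match-avoids i)) }
  ; degA-ok         = λ { zero → size ; (suc i) → degA-ok i }
  ; degB-ok         = λ j → trans (count-suc (λ i → graph′ i j))
                              (trans (cong (ind (C j) +_) (degB-ok j)) (⊖-restore d C positive j))
  }
  where
  open Star s
  open Realisation r

  graph′ : BipGraph _ _
  graph′ zero    = C
  graph′ (suc i) = graph i

  match′ : Fin _ → Fin _
  match′ zero    = partner
  match′ (suc i) = match i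

  partner-fresh : ∀ i → partner ≢ match i
  partner-fresh i p≡ = ∈-∉-absurd {S = insert partner Z}
    (subst (_∈ insert partner Z) p≡ (insert-here partner Z)) (match-avoids i)

  injective : ∀ i i' → match′ i ≡ match′ i' → i ≡ i'
  injective zero    zero     _ = refl
  injective zero    (suc i') e = contradiction e (partner-fresh i')
  injective (suc i) zero     e = contradiction (sym e) (partner-fresh i)
  injective (suc i) (suc i') e = cong suc (match-injective i i' e)

realise : (a : Fin n → ℕ) (d : Fin m → ℕ) (Z : Subset m) →
  (∀ i → 1 ≤ a i) → (∀ i → a i ≤ m) → NearRegular d → IsLow d Z →
  count Z + n ≤ m → ∑ a ≡ ∑ d → Realisation a d Z
realise {zero} a d Z _ _ _ _ _ ∑a≡∑d = record
  { graph = λ () ; match = λ () ; matched = λ () ; match-injective = λ ()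
  ; match-avoids = λ () ; degA-ok = λ ()
  ; degB-ok = λ j → sym (∑≡0 d (sym ∑a≡∑d) j) }
realise {suc n} {m} a d Z a≥1 a≤m nr low room ∑a≡∑d =
  extend s positive (realise (a ∘ suc) (d ⊖ C) (insert partner Z) (a≥1 ∘ suc) (a≤m ∘ suc)
                             (⊖-nearRegular d C nr top) (Star.low s) room′ ∑rest)
  where
  free : count Z < m
  free = ≤-trans (s≤s (m≤m+n (count Z) n)) (subst (_≤ m) (+-suc (count Z) n) room)

  s : Star d Z (a zero)
  s = star d Z nr low free (a≥1 zero) (a≤m zero)
  open Star s

  positive : ∀ j → j ∈ C → 1 ≤ d j
  positive = top-positive d C nr top
    (subst₂ _≤_ (sym size) ∑a≡∑d (m≤m+n (a zero) (∑ (a ∘ suc))))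

  room′ : count (insert partner Z) + n ≤ m
  room′ = subst (_≤ m) (trans (+-suc (count Z) n) (cong (_+ n) (sym (count-insert Z partner partner∉Z)))) room

  ∑rest : ∑ (a ∘ suc) ≡ ∑ (d ⊖ C)
  ∑rest = +-cancelˡ-≡ (a zero) _ _ (begin
    a zero + ∑ (a ∘ suc)   ≡⟨ ∑a≡∑d ⟩
    ∑ d                    ≡⟨ ∑-⊖ d C positive ⟨
    count C + ∑ (d ⊖ C)    ≡⟨ cong (_+ ∑ (d ⊖ C)) size ⟩
    a zero + ∑ (d ⊖ C)     ∎)
    where open ≡-Reasoning

zeroOf-≤ : (i : Fin n) → zeroOf i ≤ᶠ i
zeroOf-≤ {suc n} i = z≤n

≤-lastOf : (j' j : Fin n) → j' ≤ᶠ lastOf j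
≤-lastOf {suc n} j' j = ≤fromℕ j'

sorted-nearRegular : (b : Fin m → ℕ) → ((j j' : Fin m) → j ≤ᶠ j' → b j' ≤ b j) →
  ((j : Fin m) → b (zeroOf j) ≤ b (lastOf j) + 1) → NearRegular b
sorted-nearRegular b sorted spread j j' = begin
  b j                 ≤⟨ sorted (zeroOf j) j (zeroOf-≤ j) ⟩
  b (zeroOf j)        ≤⟨ spread j ⟩
  b (lastOf j) + 1    ≡⟨ +-comm (b (lastOf j)) 1 ⟩
  suc (b (lastOf j))  ≤⟨ s≤s (sorted j' (lastOf j) (≤-lastOf j' j)) ⟩
  suc (b j')          ∎
  where open ≤-Reasoning

lemma2p3 : (n m : ℕ) (a : Fin n → ℕ) (b : Fin m → ℕ) →
    ((i : Fin n) → 1 ≤ a i) →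
    ((j : Fin m) → 1 ≤ b j) →
    ((i i' : Fin n) → i ≤ᶠ i' → a i' ≤ a i) →
    ((j j' : Fin m) → j ≤ᶠ j' → b j' ≤ b j) →
    n ≤ m →
    ((i : Fin n) → a (zeroOf i) ≤ m) →
    ∑ a ≡ ∑ b →
    ((j : Fin m) → b (zeroOf j) ≤ b (lastOf j) + 1) →
    Σ (BipGraph n m) λ G →
      MatchingCoveringA G ×
      ((i : Fin n) → degA G i ≡ a i) ×
      ((j : Fin m) → degB G j ≡ b j)
lemma2p3 n m a b a≥1 _ a-sorted b-sorted n≤m a₀≤m ∑a≡∑b b-spread =
  graph , (match , matched , match-injective) , degA-ok , degB-ok
  where
  a≤m : ∀ i → a i ≤ m
  a≤m i = ≤-trans (a-sorted (zeroOf i) i (zeroOf-≤ i)) (a₀≤m i)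

  room : count {m} (λ _ → false) + n ≤ m
  room = subst (λ c → c + n ≤ m) (sym (count-empty {m})) n≤m

  open Realisation (realise a b (λ _ → false) a≥1 a≤m
                      (sorted-nearRegular b b-sorted b-spread) (λ z w ()) room ∑a≡∑b)
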